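{- For every integer $k\ge 0$, $$2^k=\sum_{n=k}^{\infty}\frac{(-1)^{n-k}4^n s(n,k)}{n!\,(2n+1)}\binom{2n}{n}^{ -1}.$$
   Context: The (signed) Stirling numbers of the first kind $s(n,k)$ are defined by $z(z-1)\cdots(z-n+1)=\sum_{k=0}^n s(n,k)z^k$. -}

module Defs where

open import Data.Nat as ℕ using (ℕ; zero; suc; _≤_; _<_; z≤n; s≤s; NonZero; _!; >-nonZero)
open import Data.Nat.Properties using (<-≤-trans; m≤m+n; _!≢0; m*n≢0)
open import Data.Nat.Combinatorics using (_C_; nCk+nC[k+1]≡[n+1]C[k+1])
open import Data.Integer as ℤ using (ℤ; +_; -[1+_])
open import Data.List using (List; []; _∷_)
open import Data.Rational as ℚ using (ℚ; _/_)
open import Relation.Binary.PropositionalEquality using (subst)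

-- Polynomials over ℤ as coefficient lists (constant term first).

Poly : Set
Poly = List ℤ

_⊕_ : Poly → Poly → Poly
[] ⊕ q = q
(a ∷ p) ⊕ [] = a ∷ p
(a ∷ p) ⊕ (b ∷ q) = (a ℤ.+ b) ∷ (p ⊕ q)

scale : ℤ → Poly → Poly
scale c [] = []
scale c (a ∷ p) = (c ℤ.* a) ∷ scale c p

mulLin : ℤ → Poly → Poly
mulLin a p = (+ 0 ∷ p) ⊕ scale (ℤ.- a) p

coeff : ℕ → Poly → ℤ
coeff k [] = + 0
coeff zero (a ∷ p) = a
coeff (suc k) (a ∷ p) = coeff k p

falling : ℕ → Poly
falling zero = + 1 ∷ []
falling (suc n) = mulLin (+ n) (falling n)

stirling1 : ℕ → ℕ → ℤ
stirling1 n k = coeff k (falling n)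

C>0 : ∀ n k → k ≤ n → 0 < n C k
C>0 n zero _ = s≤s z≤n
C>0 (suc n) (suc k) (s≤s k≤n) =
  subst (0 <_) (nCk+nC[k+1]≡[n+1]C[k+1] n k)
        (<-≤-trans (C>0 n k k≤n) (m≤m+n _ _))

denom : ℕ → ℕ
denom n = (n !) ℕ.* (suc (2 ℕ.* n)) ℕ.* ((2 ℕ.* n) C n)

denom≢0 : ∀ n → NonZero (denom n)
denom≢0 n = m*n≢0 ((n !) ℕ.* suc (2 ℕ.* n)) ((2 ℕ.* n) C n)
              {{m*n≢0 (n !) (suc (2 ℕ.* n)) {{n !≢0}}}}
              {{>-nonZero (C>0 (2 ℕ.* n) n (m≤m+n n (n ℕ.+ 0)))}}

term : ℕ → ℕ → ℚ
term k n = (((-[1+ 0 ] ℤ.^ (n ℕ.∸ k)) ℤ.* (+ (4 ℕ.^ n))) ℤ.* stirling1 n k)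
           / denom n
  where instance _ = denom≢0 n

partialSum : ℕ → ℕ → ℚ
partialSum k zero = term k k
partialSum k (suc M) = partialSum k M ℚ.+ term k (k ℕ.+ suc M)

module Submission where

-- Since s(n,k) = (-1)^(n-k) |s(n,k)|, every term is the nonnegative rational
-- 4^n |s(n,k)| / denom n, where denom n = (2n+1)!/n! satisfies
-- denom (N+1) = (4N+6) denom N.  With the weights W(k,m) = Σ_{j ≤ k} 2^(k-j) |s(m,j)|
-- the recurrence of |s| gives the telescoping identity
--     term (N+1) + R (N+1) = R N,   R N = 2 · 4^N · W(k,N+1) / denom N,
-- and R 0 + term 0 = 2^k, so the sum of the terms up to N is exactly 2^k - R N.
-- It remains to show R N → 0 with an explicit rate: the column bound
-- |s(m,j)| 4^m ≤ 4^j Π_{i<m} (4i+1) and a comparison of that product with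
-- denom N show R N < 1/(m+1) as soon as N ≥ (B (m+1))⁴ for a constant B(k).

open import Defs
open import Data.Nat using (ℕ; _≤_; _^_)
open import Data.Integer using (+_)
open import Data.Rational using (ℚ; _/_; _-_; ∣_∣; _<_; 0ℚ)
open import Data.Product using (∃-syntax)

open import Data.Nat as ℕ using (zero; suc; z≤n; s≤s; _!; NonZero)
import Data.Nat.Properties as ℕP
open import Data.Nat.Combinatorics using (_C_; k![n∸k]!∣n!)
open import Data.Nat.Combinatorics.Specification using (nCk≡n!/k![n-k]!)
open import Data.Nat.DivMod using (m/n*n≡m)
open import Data.Integer as ℤ using (ℤ; -[1+_])
import Data.Integer.Properties as ℤP
open import Data.List using ([]; _∷_)
open import Data.Rational as ℚ using (mkℚ)
import Data.Rational.Properties as ℚP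
open import Data.Rational.Unnormalised using (mkℚᵘ; *≡*; *<*; *≤*)
  renaming (_≃_ to _≃ᵘ_; _+_ to _ᵘ+_)
import Data.Rational.Unnormalised.Properties as ℚᵘP
open ℚᵘP using () renaming (module ≃-Reasoning to ≃ᵘ-Reasoning)
open import Data.Product using (_,_)
open import Data.Sum using (inj₁; inj₂)
open import Relation.Binary.PropositionalEquality
import Data.Integer.Tactic.RingSolver as ℤ-Solver
import Data.Nat.Tactic.RingSolver as ℕ-Solver

coeff-⊕ : ∀ k p q → coeff k (p ⊕ q) ≡ coeff k p ℤ.+ coeff k q
coeff-⊕ k       []      q       = sym (ℤP.+-identityˡ _)
coeff-⊕ zero    (a ∷ p) []      = sym (ℤP.+-identityʳ _)
coeff-⊕ (suc k) (a ∷ p) []      = sym (ℤP.+-identityʳ _)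
coeff-⊕ zero    (a ∷ p) (b ∷ q) = refl
coeff-⊕ (suc k) (a ∷ p) (b ∷ q) = coeff-⊕ k p q

coeff-scale : ∀ k a p → coeff k (scale a p) ≡ a ℤ.* coeff k p
coeff-scale k       a []      = sym (ℤP.*-zeroʳ a)
coeff-scale zero    a (x ∷ p) = refl
coeff-scale (suc k) a (x ∷ p) = coeff-scale k a p

coeff-mulLin : ∀ k a p → coeff k (mulLin a p) ≡ coeff k (+ 0 ∷ p) ℤ.+ ℤ.- a ℤ.* coeff k p
coeff-mulLin k a p = trans (coeff-⊕ k (+ 0 ∷ p) (scale (ℤ.- a) p))
                           (cong (λ x → coeff k (+ 0 ∷ p) ℤ.+ x) (coeff-scale k (ℤ.- a) p))

stirling1-zero : ∀ n → stirling1 (suc n) 0 ≡ ℤ.- (+ n) ℤ.* stirling1 n 0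
stirling1-zero n = trans (coeff-mulLin 0 (+ n) (falling n)) (ℤP.+-identityˡ _)

stirling1-suc : ∀ n k →
  stirling1 (suc n) (suc k) ≡ stirling1 n k ℤ.+ ℤ.- (+ n) ℤ.* stirling1 n (suc k)
stirling1-suc n k = coeff-mulLin (suc k) (+ n) (falling n)

stirlingU : ℕ → ℕ → ℕ
stirlingU zero    zero    = 1
stirlingU zero    (suc k) = 0
stirlingU (suc n) zero    = n ℕ.* stirlingU n zero
stirlingU (suc n) (suc k) = stirlingU n k ℕ.+ n ℕ.* stirlingU n (suc k)

stirlingU-above : ∀ n k → n ℕ.< k → stirlingU n k ≡ 0
stirlingU-above zero    (suc k) _         = refl
stirlingU-above (suc n) (suc k) (s≤s n<k)
  rewrite stirlingU-above n k n<k | stirlingU-above n (suc k) (ℕP.m<n⇒m<1+n n<k) =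
  ℕP.*-zeroʳ n

-- (-1)^m, written exactly as in the definition of `term`.
sign : ℕ → ℤ
sign m = -[1+ 0 ] ℤ.^ m

-- The sign in `term` cancels the sign of s(n,k).
sign-square : ∀ m → sign m ℤ.* sign m ≡ + 1
sign-square zero    = refl
sign-square (suc m) = trans (negate-twice (sign m)) (sign-square m)
  where
  negate-twice : ∀ x → (-[1+ 0 ] ℤ.* x) ℤ.* (-[1+ 0 ] ℤ.* x) ≡ x ℤ.* x
  negate-twice = ℤ-Solver.solve-∀

-- Moving from column k+1 to column k flips the sign; when k ≥ n the
-- entry vanishes, so the identity holds for all n and k.
sign-shift : ∀ n k →
  ℤ.- (sign (n ℕ.∸ suc k) ℤ.* + stirlingU n (suc k)) ≡ sign (n ℕ.∸ k) ℤ.* + stirlingU n (suc k)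
sign-shift n k with ℕP.<-≤-connex k n
... | inj₁ k<n = begin
  ℤ.- (sign (n ℕ.∸ suc k) ℤ.* x)         ≡⟨ negate (sign (n ℕ.∸ suc k)) x ⟩
  sign (suc (n ℕ.∸ suc k)) ℤ.* x         ≡⟨ cong (λ m → sign m ℤ.* x) (ℕP.+-∸-assoc 1 k<n) ⟨
  sign (n ℕ.∸ k) ℤ.* x                   ∎
  where open ≡-Reasoning
        x = + stirlingU n (suc k)
        negate : ∀ s a → ℤ.- (s ℤ.* a) ≡ (-[1+ 0 ] ℤ.* s) ℤ.* a
        negate = ℤ-Solver.solve-∀
... | inj₂ n≤k rewrite stirlingU-above n (suc k) (s≤s n≤k)
                     | ℤP.*-zeroʳ (sign (n ℕ.∸ suc k))
                     | ℤP.*-zeroʳ (sign (n ℕ.∸ k)) = refl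

stirling1-sign : ∀ n k → stirling1 n k ≡ sign (n ℕ.∸ k) ℤ.* + stirlingU n k
stirling1-sign zero    zero    = refl
stirling1-sign zero    (suc k) = refl
stirling1-sign (suc n) zero    = begin
  stirling1 (suc n) 0                       ≡⟨ stirling1-zero n ⟩
  ℤ.- (+ n) ℤ.* stirling1 n 0               ≡⟨ cong (ℤ.- (+ n) ℤ.*_) (stirling1-sign n 0) ⟩
  ℤ.- (+ n) ℤ.* (sign n ℤ.* + stirlingU n 0) ≡⟨ regroup (+ n) (sign n) (+ stirlingU n 0) ⟩
  sign (suc n) ℤ.* (+ n ℤ.* + stirlingU n 0) ≡⟨ cong (sign (suc n) ℤ.*_) (ℤP.pos-* n (stirlingU n 0)) ⟨
  sign (suc n) ℤ.* + stirlingU (suc n) 0     ∎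
  where open ≡-Reasoning
        regroup : ∀ a s b → ℤ.- a ℤ.* (s ℤ.* b) ≡ (-[1+ 0 ] ℤ.* s) ℤ.* (a ℤ.* b)
        regroup = ℤ-Solver.solve-∀
stirling1-sign (suc n) (suc k) = begin
  stirling1 (suc n) (suc k)                            ≡⟨ stirling1-suc n k ⟩
  stirling1 n k ℤ.+ ℤ.- (+ n) ℤ.* stirling1 n (suc k) ≡⟨ cong₂ (λ a b → a ℤ.+ ℤ.- (+ n) ℤ.* b)
                                                              (stirling1-sign n k) (stirling1-sign n (suc k)) ⟩
  σ ℤ.* x ℤ.+ ℤ.- (+ n) ℤ.* (σ′ ℤ.* y)                 ≡⟨ move-minus σ x (+ n) (σ′ ℤ.* y) ⟩
  σ ℤ.* x ℤ.+ + n ℤ.* ℤ.- (σ′ ℤ.* y)                   ≡⟨ cong (λ z → σ ℤ.* x ℤ.+ + n ℤ.* z) (sign-shift n k) ⟩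
  σ ℤ.* x ℤ.+ + n ℤ.* (σ ℤ.* y)                        ≡⟨ factor σ x (+ n) y ⟩
  σ ℤ.* (x ℤ.+ + n ℤ.* y)                              ≡⟨ cong (λ z → σ ℤ.* (x ℤ.+ z)) (ℤP.pos-* n (stirlingU n (suc k))) ⟨
  σ ℤ.* + stirlingU (suc n) (suc k)                    ∎
  where open ≡-Reasoning
        σ  = sign (n ℕ.∸ k)
        σ′ = sign (n ℕ.∸ suc k)
        x  = + stirlingU n k
        y  = + stirlingU n (suc k)
        move-minus : ∀ s a m b → s ℤ.* a ℤ.+ ℤ.- m ℤ.* b ≡ s ℤ.* a ℤ.+ m ℤ.* ℤ.- b
        move-minus = ℤ-Solver.solve-∀
        factor : ∀ s a m b → s ℤ.* a ℤ.+ m ℤ.* (s ℤ.* b) ≡ s ℤ.* (a ℤ.+ m ℤ.* b)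
        factor = ℤ-Solver.solve-∀

term-numerator : ∀ k n →
  (sign (n ℕ.∸ k) ℤ.* + (4 ^ n)) ℤ.* stirling1 n k ≡ + (4 ^ n ℕ.* stirlingU n k)
term-numerator k n = begin
  (σ ℤ.* + (4 ^ n)) ℤ.* stirling1 n k              ≡⟨ cong ((σ ℤ.* + (4 ^ n)) ℤ.*_) (stirling1-sign n k) ⟩
  (σ ℤ.* + (4 ^ n)) ℤ.* (σ ℤ.* + stirlingU n k)    ≡⟨ regroup σ (+ (4 ^ n)) (+ stirlingU n k) ⟩
  (σ ℤ.* σ) ℤ.* (+ (4 ^ n) ℤ.* + stirlingU n k)    ≡⟨ cong (ℤ._* (+ (4 ^ n) ℤ.* + stirlingU n k)) (sign-square (n ℕ.∸ k)) ⟩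
  + 1 ℤ.* (+ (4 ^ n) ℤ.* + stirlingU n k)          ≡⟨ ℤP.*-identityˡ _ ⟩
  + (4 ^ n) ℤ.* + stirlingU n k                    ≡⟨ ℤP.pos-* (4 ^ n) (stirlingU n k) ⟨
  + (4 ^ n ℕ.* stirlingU n k)                      ∎
  where open ≡-Reasoning
        σ = sign (n ℕ.∸ k)
        regroup : ∀ s a b → (s ℤ.* a) ℤ.* (s ℤ.* b) ≡ (s ℤ.* s) ℤ.* (a ℤ.* b)
        regroup = ℤ-Solver.solve-∀

binomial-factorials : ∀ {n k} → k ≤ n → (n C k) ℕ.* (k ! ℕ.* (n ℕ.∸ k) !) ≡ n !
binomial-factorials {n} {k} k≤n =
  trans (cong (ℕ._* (k ! ℕ.* (n ℕ.∸ k) !)) (nCk≡n!/k![n-k]! k≤n)) (m/n*n≡m {{_}} (k![n∸k]!∣n! k≤n))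

denom-factorial : ∀ N → denom N ℕ.* N ! ≡ suc (2 ℕ.* N) !
denom-factorial N = begin
  N ! ℕ.* suc (2 ℕ.* N) ℕ.* ((2 ℕ.* N) C N) ℕ.* N !    ≡⟨ regroup (N !) (suc (2 ℕ.* N)) ((2 ℕ.* N) C N) ⟩
  suc (2 ℕ.* N) ℕ.* (((2 ℕ.* N) C N) ℕ.* (N ! ℕ.* N !)) ≡⟨ cong (λ m → suc (2 ℕ.* N) ℕ.* (((2 ℕ.* N) C N) ℕ.* (N ! ℕ.* m !))) 2N∸N≡N ⟨
  suc (2 ℕ.* N) ℕ.* (((2 ℕ.* N) C N) ℕ.* (N ! ℕ.* (2 ℕ.* N ℕ.∸ N) !))
      ≡⟨ cong (suc (2 ℕ.* N) ℕ.*_) (binomial-factorials (ℕP.m≤m+n N (N ℕ.+ 0))) ⟩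
  suc (2 ℕ.* N) ! ∎
  where open ≡-Reasoning
        2N∸N≡N : 2 ℕ.* N ℕ.∸ N ≡ N
        2N∸N≡N = trans (ℕP.m+n∸m≡n N (N ℕ.+ 0)) (ℕP.+-identityʳ N)
        regroup : ∀ f a b → f ℕ.* a ℕ.* b ℕ.* f ≡ a ℕ.* (b ℕ.* (f ℕ.* f))
        regroup = ℕ-Solver.solve-∀

-- Consecutive denominators differ by the factor (2N+2)(2N+3)/(N+1) = 4N+6.
denom-step : ∀ N → denom (suc N) ≡ (4 ℕ.* N ℕ.+ 6) ℕ.* denom N
denom-step N = ℕP.*-cancelʳ-≡ _ _ (suc N !) {{(suc N) ℕP.!≢0}} (begin
  denom (suc N) ℕ.* suc N !                           ≡⟨ denom-factorial (suc N) ⟩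
  suc (2 ℕ.* suc N) !                                 ≡⟨ cong (λ m → suc m !) (double-suc N) ⟩
  suc (suc (suc (2 ℕ.* N))) ℕ.* (suc (suc (2 ℕ.* N)) ℕ.* suc (2 ℕ.* N) !)
                                                      ≡⟨ cong (λ m → suc (suc (suc (2 ℕ.* N))) ℕ.* (suc (suc (2 ℕ.* N)) ℕ.* m))
                                                              (denom-factorial N) ⟨
  suc (suc (suc (2 ℕ.* N))) ℕ.* (suc (suc (2 ℕ.* N)) ℕ.* (denom N ℕ.* N !))
                                                      ≡⟨ regroup N (denom N) (N !) ⟩
  (4 ℕ.* N ℕ.+ 6) ℕ.* denom N ℕ.* suc N !             ∎)
  where open ≡-Reasoning
        double-suc : ∀ N → 2 ℕ.* suc N ≡ suc (suc (2 ℕ.* N))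
        double-suc = ℕ-Solver.solve-∀
        regroup : ∀ N d f → suc (suc (suc (2 ℕ.* N))) ℕ.* (suc (suc (2 ℕ.* N)) ℕ.* (d ℕ.* f))
                            ≡ (4 ℕ.* N ℕ.+ 6) ℕ.* d ℕ.* (suc N ℕ.* f)
        regroup = ℕ-Solver.solve-∀

-- Tail weights  W(k,m) = Σ_{j ≤ k} 2^(k-j) |s(m,j)|.  The remainder of the
-- series after the term n = N turns out to be 2 · 4^N · W(k,N+1) / denom N.
tailWeight : ℕ → ℕ → ℕ
tailWeight zero    m = stirlingU m 0
tailWeight (suc k) m = 2 ℕ.* tailWeight k m ℕ.+ stirlingU m (suc k)

-- The recurrence of |s| in m transfers to the weights; this is what makes
-- the remainders telescope.
tailWeight-step : ∀ k m →
  2 ℕ.* tailWeight k (suc m) ℕ.+ stirlingU m k ≡ (2 ℕ.* m ℕ.+ 1) ℕ.* tailWeight k m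
tailWeight-step zero    m = distribute m (stirlingU m 0)
  where distribute : ∀ m x → 2 ℕ.* (m ℕ.* x) ℕ.+ x ≡ (2 ℕ.* m ℕ.+ 1) ℕ.* x
        distribute = ℕ-Solver.solve-∀
tailWeight-step (suc k) m = begin
  2 ℕ.* (2 ℕ.* W′ ℕ.+ (a ℕ.+ m ℕ.* b)) ℕ.+ b   ≡⟨ regroup W′ a m b ⟩
  2 ℕ.* (2 ℕ.* W′ ℕ.+ a) ℕ.+ (2 ℕ.* m ℕ.+ 1) ℕ.* b
                                                ≡⟨ cong (λ x → 2 ℕ.* x ℕ.+ (2 ℕ.* m ℕ.+ 1) ℕ.* b) (tailWeight-step k m) ⟩
  2 ℕ.* ((2 ℕ.* m ℕ.+ 1) ℕ.* W) ℕ.+ (2 ℕ.* m ℕ.+ 1) ℕ.* b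
                                                ≡⟨ factor W b m ⟩
  (2 ℕ.* m ℕ.+ 1) ℕ.* (2 ℕ.* W ℕ.+ b)          ∎
  where open ≡-Reasoning
        W′ = tailWeight k (suc m)
        W  = tailWeight k m
        a  = stirlingU m k
        b  = stirlingU m (suc k)
        regroup : ∀ X a m b → 2 ℕ.* (2 ℕ.* X ℕ.+ (a ℕ.+ m ℕ.* b)) ℕ.+ b
                              ≡ 2 ℕ.* (2 ℕ.* X ℕ.+ a) ℕ.+ (2 ℕ.* m ℕ.+ 1) ℕ.* b
        regroup = ℕ-Solver.solve-∀
        factor : ∀ Y b m → 2 ℕ.* ((2 ℕ.* m ℕ.+ 1) ℕ.* Y) ℕ.+ (2 ℕ.* m ℕ.+ 1) ℕ.* b
                           ≡ (2 ℕ.* m ℕ.+ 1) ℕ.* (2 ℕ.* Y ℕ.+ b)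
        factor = ℕ-Solver.solve-∀

-- Numerator form of "term 0 plus the remainder after it is 2^k".
tailWeight-initial : ∀ k → stirlingU 0 k ℕ.+ 2 ℕ.* tailWeight k 1 ≡ 2 ^ k
tailWeight-initial zero    = refl
tailWeight-initial (suc k) = begin
  0 ℕ.+ 2 ℕ.* (2 ℕ.* W ℕ.+ (x ℕ.+ 0)) ≡⟨ regroup W x ⟩
  2 ℕ.* (x ℕ.+ 2 ℕ.* W)               ≡⟨ cong (2 ℕ.*_) (tailWeight-initial k) ⟩
  2 ^ suc k                            ∎
  where open ≡-Reasoning
        W = tailWeight k 1
        x = stirlingU 0 k
        regroup : ∀ e x → 0 ℕ.+ 2 ℕ.* (2 ℕ.* e ℕ.+ (x ℕ.+ 0)) ≡ 2 ℕ.* (x ℕ.+ 2 ℕ.* e)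
        regroup = ℕ-Solver.solve-∀

shiftedProduct : ℕ → ℕ → ℕ
shiftedProduct a zero    = 1
shiftedProduct a (suc m) = (a ℕ.* m ℕ.+ 1) ℕ.* shiftedProduct a m

-- For every a:  |s(m,j)| ≤ a^j Π_{i<m} (i + 1/a),  a bound of order
-- a^j Γ(m + 1/a) that is uniform in the column j.
stirlingU-bound : ∀ a m j → stirlingU m j ℕ.* a ^ m ≤ a ^ j ℕ.* shiftedProduct a m
stirlingU-bound a zero    zero    = ℕP.≤-refl
stirlingU-bound a zero    (suc j) = z≤n
stirlingU-bound a (suc m) zero    = begin
  m ℕ.* stirlingU m 0 ℕ.* (a ℕ.* a ^ m)   ≡⟨ regroup a m (stirlingU m 0) (a ^ m) ⟩
  a ℕ.* m ℕ.* (stirlingU m 0 ℕ.* a ^ m)   ≤⟨ ℕP.*-monoʳ-≤ (a ℕ.* m) (stirlingU-bound a m 0) ⟩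
  a ℕ.* m ℕ.* (1 ℕ.* P)                   ≤⟨ ℕP.m≤n+m _ P ⟩
  P ℕ.+ a ℕ.* m ℕ.* (1 ℕ.* P)             ≡⟨ factor a m P ⟩
  1 ℕ.* ((a ℕ.* m ℕ.+ 1) ℕ.* P)           ∎
  where open ℕP.≤-Reasoning
        P = shiftedProduct a m
        regroup : ∀ a m x y → m ℕ.* x ℕ.* (a ℕ.* y) ≡ a ℕ.* m ℕ.* (x ℕ.* y)
        regroup = ℕ-Solver.solve-∀
        factor : ∀ a m p → p ℕ.+ a ℕ.* m ℕ.* (1 ℕ.* p) ≡ 1 ℕ.* ((a ℕ.* m ℕ.+ 1) ℕ.* p)
        factor = ℕ-Solver.solve-∀
stirlingU-bound a (suc m) (suc j) = begin
  (stirlingU m j ℕ.+ m ℕ.* stirlingU m (suc j)) ℕ.* (a ℕ.* a ^ m)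
    ≡⟨ regroup a (stirlingU m j) m (stirlingU m (suc j)) (a ^ m) ⟩
  a ℕ.* (stirlingU m j ℕ.* a ^ m) ℕ.+ a ℕ.* m ℕ.* (stirlingU m (suc j) ℕ.* a ^ m)
    ≤⟨ ℕP.+-mono-≤ (ℕP.*-monoʳ-≤ a (stirlingU-bound a m j))
                   (ℕP.*-monoʳ-≤ (a ℕ.* m) (stirlingU-bound a m (suc j))) ⟩
  a ℕ.* (a ^ j ℕ.* P) ℕ.+ a ℕ.* m ℕ.* (a ℕ.* a ^ j ℕ.* P)
    ≡⟨ factor a (a ^ j) m P ⟩
  a ℕ.* a ^ j ℕ.* ((a ℕ.* m ℕ.+ 1) ℕ.* P) ∎
  where open ℕP.≤-Reasoning
        P = shiftedProduct a m
        regroup : ∀ a x m y z → (x ℕ.+ m ℕ.* y) ℕ.* (a ℕ.* z)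
                                ≡ a ℕ.* (x ℕ.* z) ℕ.+ a ℕ.* m ℕ.* (y ℕ.* z)
        regroup = ℕ-Solver.solve-∀
        factor : ∀ a q m p → a ℕ.* (q ℕ.* p) ℕ.+ a ℕ.* m ℕ.* (a ℕ.* q ℕ.* p)
                             ≡ a ℕ.* q ℕ.* ((a ℕ.* m ℕ.+ 1) ℕ.* p)
        factor = ℕ-Solver.solve-∀

weightConstant : ℕ → ℕ → ℕ
weightConstant a zero    = 1
weightConstant a (suc k) = 2 ℕ.* weightConstant a k ℕ.+ a ^ suc k

tailWeight-bound : ∀ a k m → tailWeight k m ℕ.* a ^ m ≤ weightConstant a k ℕ.* shiftedProduct a m
tailWeight-bound a zero    m = stirlingU-bound a m 0
tailWeight-bound a (suc k) m = begin
  (2 ℕ.* tailWeight k m ℕ.+ stirlingU m (suc k)) ℕ.* a ^ m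
    ≡⟨ ℕP.*-distribʳ-+ (a ^ m) (2 ℕ.* tailWeight k m) (stirlingU m (suc k)) ⟩
  2 ℕ.* tailWeight k m ℕ.* a ^ m ℕ.+ stirlingU m (suc k) ℕ.* a ^ m
    ≡⟨ cong (ℕ._+ stirlingU m (suc k) ℕ.* a ^ m) (ℕP.*-assoc 2 (tailWeight k m) (a ^ m)) ⟩
  2 ℕ.* (tailWeight k m ℕ.* a ^ m) ℕ.+ stirlingU m (suc k) ℕ.* a ^ m
    ≤⟨ ℕP.+-mono-≤ (ℕP.*-monoʳ-≤ 2 (tailWeight-bound a k m)) (stirlingU-bound a m (suc k)) ⟩
  2 ℕ.* (weightConstant a k ℕ.* P) ℕ.+ a ^ suc k ℕ.* P
    ≡⟨ factor (weightConstant a k) P (a ^ suc k) ⟩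
  weightConstant a (suc k) ℕ.* P ∎
  where open ℕP.≤-Reasoning
        P = shiftedProduct a m
        factor : ∀ b p q → 2 ℕ.* (b ℕ.* p) ℕ.+ q ℕ.* p ≡ (2 ℕ.* b ℕ.+ q) ℕ.* p
        factor = ℕ-Solver.solve-∀

-- Fourth powers, written as products so that the ring solver sees through them.
_⁴ : ℕ → ℕ
x ⁴ = (x ℕ.* x) ℕ.* (x ℕ.* x)

⁴-mono-≤ : ∀ {x y} → x ≤ y → x ⁴ ≤ y ⁴
⁴-mono-≤ x≤y = ℕP.*-mono-≤ (ℕP.*-mono-≤ x≤y x≤y) (ℕP.*-mono-≤ x≤y x≤y)

⁴-cancel-< : ∀ {x y} → x ⁴ ℕ.< y ⁴ → x ℕ.< y
⁴-cancel-< x⁴<y⁴ = ℕP.≰⇒> (λ y≤x → ℕP.<⇒≱ x⁴<y⁴ (⁴-mono-≤ y≤x))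

-- a³(a+4) ≤ (a+1)⁴: the one-step growth inequality behind the next lemma.
cube-times-shift≤ : ∀ a → a ℕ.* a ℕ.* a ℕ.* (a ℕ.+ 4) ≤ suc a ⁴
cube-times-shift≤ a = subst (a ℕ.* a ℕ.* a ℕ.* (a ℕ.+ 4) ≤_) (sym (expand a)) (ℕP.m≤m+n _ _)
  where expand : ∀ a → (1 ℕ.+ a) ℕ.* (1 ℕ.+ a) ℕ.* ((1 ℕ.+ a) ℕ.* (1 ℕ.+ a))
                       ≡ a ℕ.* a ℕ.* a ℕ.* (a ℕ.+ 4) ℕ.+ (6 ℕ.* a ℕ.* a ℕ.+ 4 ℕ.* a ℕ.+ 1)
        expand = ℕ-Solver.solve-∀

-- Π_{i ≤ N} (4i+1) is small against denom N:  its fourth power, times 4N+5,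
-- is at most 5 · (denom N)⁴.  (The ratio decays like N^(-1/4).)
shiftedProduct-vs-denom : ∀ N →
  shiftedProduct 4 (suc N) ⁴ ℕ.* (4 ℕ.* N ℕ.+ 5) ≤ 5 ℕ.* denom N ⁴
shiftedProduct-vs-denom zero    = ℕP.≤-refl
shiftedProduct-vs-denom (suc N) = begin
  ((4 ℕ.* suc N ℕ.+ 1) ℕ.* P) ⁴ ℕ.* (4 ℕ.* suc N ℕ.+ 5) ≡⟨ regroup N P ⟩
  a³⁺ ℕ.* (P ⁴ ℕ.* (4 ℕ.* N ℕ.+ 5))                   ≤⟨ ℕP.*-monoʳ-≤ a³⁺ (shiftedProduct-vs-denom N) ⟩
  a³⁺ ℕ.* (5 ℕ.* D ⁴)                                  ≤⟨ ℕP.*-monoˡ-≤ (5 ℕ.* D ⁴) (cube-times-shift≤ a) ⟩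
  suc a ⁴ ℕ.* (5 ℕ.* D ⁴)                              ≡⟨ regroup′ N D ⟩
  5 ℕ.* ((4 ℕ.* N ℕ.+ 6) ℕ.* D) ⁴                      ≡⟨ cong (λ x → 5 ℕ.* x ⁴) (denom-step N) ⟨
  5 ℕ.* denom (suc N) ⁴                                 ∎
  where open ℕP.≤-Reasoning
        a = 4 ℕ.* N ℕ.+ 5
        a³⁺ = a ℕ.* a ℕ.* a ℕ.* (a ℕ.+ 4)
        P = shiftedProduct 4 (suc N)
        D = denom N
        regroup : ∀ N p → let b = (4 ℕ.* (1 ℕ.+ N) ℕ.+ 1) ℕ.* p ; a = 4 ℕ.* N ℕ.+ 5 in
                  b ℕ.* b ℕ.* (b ℕ.* b) ℕ.* (4 ℕ.* (1 ℕ.+ N) ℕ.+ 5)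
                  ≡ a ℕ.* a ℕ.* a ℕ.* (a ℕ.+ 4) ℕ.* (p ℕ.* p ℕ.* (p ℕ.* p) ℕ.* a)
        regroup = ℕ-Solver.solve-∀
        regroup′ : ∀ N d → let c = 1 ℕ.+ (4 ℕ.* N ℕ.+ 5) ; b = (4 ℕ.* N ℕ.+ 6) ℕ.* d in
                   c ℕ.* c ℕ.* (c ℕ.* c) ℕ.* (5 ℕ.* (d ℕ.* d ℕ.* (d ℕ.* d))) ≡ 5 ℕ.* (b ℕ.* b ℕ.* (b ℕ.* b))
        regroup′ = ℕ-Solver.solve-∀

-- Fractions of natural numbers in ℚ.  Their arithmetic is checked on the
-- unnormalised representation, where it is a polynomial identity in ℤ.
module Fractions where

  toℚᵘ-fraction : ∀ a d → ℚ.toℚᵘ (+ a ℚ./ suc d) ≃ᵘ mkℚᵘ (+ a) d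
  toℚᵘ-fraction a d = ℚP.toℚᵘ-fromℚᵘ (mkℚᵘ (+ a) d)

  fraction-cong : ∀ a b d e .{{_ : NonZero d}} .{{_ : NonZero e}} →
    a ℕ.* e ≡ b ℕ.* d → + a ℚ./ d ≡ + b ℚ./ e
  fraction-cong a b (suc d) (suc e) ae≡bd = ℚP.toℚᵘ-injective (begin
    ℚ.toℚᵘ (+ a ℚ./ suc d) ≈⟨ toℚᵘ-fraction a d ⟩
    mkℚᵘ (+ a) d           ≈⟨ *≡* cross ⟩
    mkℚᵘ (+ b) e           ≈⟨ toℚᵘ-fraction b e ⟨
    ℚ.toℚᵘ (+ b ℚ./ suc e) ∎)
    where
    open ≃ᵘ-Reasoning
    cross : + a ℤ.* + suc e ≡ + b ℤ.* + suc d
    cross = trans (sym (ℤP.pos-* a (suc e))) (trans (cong +_ ae≡bd) (ℤP.pos-* b (suc d)))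

  fraction-+ : ∀ a b d .{{_ : NonZero d}} → + a ℚ./ d ℚ.+ + b ℚ./ d ≡ + (a ℕ.+ b) ℚ./ d
  fraction-+ a b (suc d) = ℚP.toℚᵘ-injective (begin
    ℚ.toℚᵘ (+ a ℚ./ suc d ℚ.+ + b ℚ./ suc d)        ≈⟨ ℚP.toℚᵘ-homo-+ (+ a ℚ./ suc d) (+ b ℚ./ suc d) ⟩
    ℚ.toℚᵘ (+ a ℚ./ suc d) ᵘ+ ℚ.toℚᵘ (+ b ℚ./ suc d) ≈⟨ ℚᵘP.+-cong (toℚᵘ-fraction a d) (toℚᵘ-fraction b d) ⟩
    mkℚᵘ (+ a) d ᵘ+ mkℚᵘ (+ b) d                     ≈⟨ *≡* cross ⟩
    mkℚᵘ (+ (a ℕ.+ b)) d                             ≈⟨ toℚᵘ-fraction (a ℕ.+ b) d ⟨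
    ℚ.toℚᵘ (+ (a ℕ.+ b) ℚ./ suc d)                  ∎)
    where
    open ≃ᵘ-Reasoning
    D = + suc d
    cross : (+ a ℤ.* D ℤ.+ + b ℤ.* D) ℤ.* D ≡ + (a ℕ.+ b) ℤ.* + (suc d ℕ.* suc d)
    cross = trans (factor (+ a) (+ b) D)
                  (sym (cong₂ ℤ._*_ (ℤP.pos-+ a b) (ℤP.pos-* (suc d) (suc d))))
      where factor : ∀ x y z → (x ℤ.* z ℤ.+ y ℤ.* z) ℤ.* z ≡ (x ℤ.+ y) ℤ.* (z ℤ.* z)
            factor = ℤ-Solver.solve-∀

  fraction-nonNegative : ∀ a d .{{_ : NonZero d}} → 0ℚ ℚ.≤ + a ℚ./ d
  fraction-nonNegative a d = ℚP.nonNegative⁻¹ (+ a ℚ./ d) {{ℚP.normalize-nonNeg a d}}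

  fraction<reciprocal : ∀ a d m .{{_ : NonZero d}} → a ℕ.* suc m ℕ.< d → + a ℚ./ d ℚ.< + 1 ℚ./ suc m
  fraction<reciprocal a (suc d) m a[m+1]<d = ℚP.toℚᵘ-cancel-<
    (ℚᵘP.<-respʳ-≃ (ℚᵘP.≃-sym (toℚᵘ-fraction 1 m))
      (ℚᵘP.<-respˡ-≃ (ℚᵘP.≃-sym (toℚᵘ-fraction a d)) (*<* cross)))
    where
    cross : + a ℤ.* + suc m ℤ.< + 1 ℤ.* + suc d
    cross = subst₂ ℤ._<_ (ℤP.pos-* a (suc m)) (sym (ℤP.*-identityˡ (+ suc d))) (ℤ.+<+ a[m+1]<d)

  reciprocal-below : ∀ ε → 0ℚ ℚ.< ε → ∃[ m ] (+ 1 ℚ./ suc m ℚ.≤ ε)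
  reciprocal-below (mkℚ (+ suc p) m _) _ = m , ℚP.toℚᵘ-cancel-≤
    (ℚᵘP.≤-respˡ-≃ (ℚᵘP.≃-sym (toℚᵘ-fraction 1 m))
      (*≤* (ℤ.+≤+ (ℕP.*-monoˡ-≤ (suc m) (s≤s (z≤n {p}))))))
  reciprocal-below (mkℚ (+ zero)   _ _) (ℚ.*<* (ℤ.+<+ ()))
  reciprocal-below (mkℚ -[1+ _ ]   _ _) (ℚ.*<* ())

remainderNumerator : ℕ → ℕ → ℕ
remainderNumerator k N = 2 ℕ.* 4 ^ N ℕ.* tailWeight k (suc N)

-- Numerators of consecutive remainders: the (N+1)-st term together with the
-- remainder after it is (4N+6) times the remainder after N, matching
-- denom (N+1) = (4N+6) denom N.
remainderNumerator-step : ∀ k N →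
  4 ^ suc N ℕ.* stirlingU (suc N) k ℕ.+ remainderNumerator k (suc N)
    ≡ (4 ℕ.* N ℕ.+ 6) ℕ.* remainderNumerator k N
remainderNumerator-step k N = begin
  4 ℕ.* q ℕ.* x ℕ.+ 2 ℕ.* (4 ℕ.* q) ℕ.* W′          ≡⟨ regroup q x W′ ⟩
  4 ℕ.* q ℕ.* (2 ℕ.* W′ ℕ.+ x)                       ≡⟨ cong (4 ℕ.* q ℕ.*_) (tailWeight-step k (suc N)) ⟩
  4 ℕ.* q ℕ.* ((2 ℕ.* suc N ℕ.+ 1) ℕ.* W)            ≡⟨ regroup′ q N W ⟩
  (4 ℕ.* N ℕ.+ 6) ℕ.* (2 ℕ.* q ℕ.* W)                ∎
  where open ≡-Reasoning
        q  = 4 ^ N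
        x  = stirlingU (suc N) k
        W  = tailWeight k (suc N)
        W′ = tailWeight k (suc (suc N))
        regroup : ∀ q x w → 4 ℕ.* q ℕ.* x ℕ.+ 2 ℕ.* (4 ℕ.* q) ℕ.* w ≡ 4 ℕ.* q ℕ.* (2 ℕ.* w ℕ.+ x)
        regroup = ℕ-Solver.solve-∀
        regroup′ : ∀ q N w → 4 ℕ.* q ℕ.* ((2 ℕ.* (1 ℕ.+ N) ℕ.+ 1) ℕ.* w) ≡ (4 ℕ.* N ℕ.+ 6) ℕ.* (2 ℕ.* q ℕ.* w)
        regroup′ = ℕ-Solver.solve-∀

product-below-denom : ∀ X N → X ⁴ ≤ N → X ℕ.* shiftedProduct 4 (suc N) ℕ.< 2 ℕ.* denom N
product-below-denom X N X⁴≤N = ⁴-cancel-< (ℕP.*-cancelʳ-< _ _ _ (begin-strict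
  (X ℕ.* P) ⁴ ℕ.* w        ≡⟨ regroup X P w ⟩
  X ⁴ ℕ.* (P ⁴ ℕ.* w)      ≤⟨ ℕP.*-monoʳ-≤ (X ⁴) (shiftedProduct-vs-denom N) ⟩
  X ⁴ ℕ.* (5 ℕ.* D ⁴)      ≡⟨ swap (X ⁴) (D ⁴) ⟩
  5 ℕ.* X ⁴ ℕ.* D ⁴        ≤⟨ ℕP.*-monoˡ-≤ (D ⁴) (ℕP.*-monoʳ-≤ 5 X⁴≤N) ⟩
  5 ℕ.* N ℕ.* D ⁴          <⟨ ℕP.*-monoˡ-< (D ⁴) {{D⁴≢0}} (five-N<sixteen-w N) ⟩
  16 ℕ.* w ℕ.* D ⁴         ≡⟨ regroup′ w D ⟩
  (2 ℕ.* D) ⁴ ℕ.* w        ∎))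
  where open ℕP.≤-Reasoning
        P = shiftedProduct 4 (suc N)
        D = denom N
        w = 4 ℕ.* N ℕ.+ 5
        D⁴≢0 : NonZero (D ⁴)
        D⁴≢0 = ℕP.m*n≢0 (D ℕ.* D) (D ℕ.* D) {{D²≢0}} {{D²≢0}}
          where D²≢0 = ℕP.m*n≢0 D D {{denom≢0 N}} {{denom≢0 N}}
        swap : ∀ a b → a ℕ.* (5 ℕ.* b) ≡ 5 ℕ.* a ℕ.* b
        swap = ℕ-Solver.solve-∀
        five-N<sixteen-w : ∀ N → 5 ℕ.* N ℕ.< 16 ℕ.* (4 ℕ.* N ℕ.+ 5)
        five-N<sixteen-w N = subst (5 ℕ.* N ℕ.<_) (sym (expand N)) (ℕP.m<m+n (5 ℕ.* N) (s≤s z≤n))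
          where expand : ∀ N → 16 ℕ.* (4 ℕ.* N ℕ.+ 5) ≡ 5 ℕ.* N ℕ.+ (80 ℕ.+ 59 ℕ.* N)
                expand = ℕ-Solver.solve-∀
        regroup : ∀ x p w → (x ℕ.* p) ℕ.* (x ℕ.* p) ℕ.* ((x ℕ.* p) ℕ.* (x ℕ.* p)) ℕ.* w
                            ≡ x ℕ.* x ℕ.* (x ℕ.* x) ℕ.* (p ℕ.* p ℕ.* (p ℕ.* p) ℕ.* w)
        regroup = ℕ-Solver.solve-∀
        regroup′ : ∀ w d → 16 ℕ.* w ℕ.* (d ℕ.* d ℕ.* (d ℕ.* d))
                           ≡ (2 ℕ.* d) ℕ.* (2 ℕ.* d) ℕ.* ((2 ℕ.* d) ℕ.* (2 ℕ.* d)) ℕ.* w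
        regroup′ = ℕ-Solver.solve-∀

-- The remainder after the term n = N is below 1/(m+1) once N ≥ (B·(m+1))⁴,
-- B = Σ_{j ≤ k} 2^(k-j) 4^j; stated here with denominators cleared.
remainderNumerator-bound : ∀ k m N → (weightConstant 4 k ℕ.* suc m) ⁴ ≤ N →
  remainderNumerator k N ℕ.* suc m ℕ.< denom N
remainderNumerator-bound k m N X⁴≤N = ℕP.*-cancelˡ-< 2 _ _ (begin-strict
  2 ℕ.* (remainderNumerator k N ℕ.* suc m)       ≡⟨ regroup (4 ^ N) W (suc m) ⟩
  W ℕ.* 4 ^ suc N ℕ.* suc m                      ≤⟨ ℕP.*-monoˡ-≤ (suc m) (tailWeight-bound 4 k (suc N)) ⟩
  B ℕ.* P ℕ.* suc m                              ≡⟨ ℕP.*-assoc B P (suc m) ⟩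
  B ℕ.* (P ℕ.* suc m)                            ≡⟨ cong (B ℕ.*_) (ℕP.*-comm P (suc m)) ⟩
  B ℕ.* (suc m ℕ.* P)                            ≡⟨ ℕP.*-assoc B (suc m) P ⟨
  B ℕ.* suc m ℕ.* P                              <⟨ product-below-denom (B ℕ.* suc m) N X⁴≤N ⟩
  2 ℕ.* denom N                                  ∎)
  where open ℕP.≤-Reasoning
        W = tailWeight k (suc N)
        B = weightConstant 4 k
        P = shiftedProduct 4 (suc N)
        regroup : ∀ q w r → 2 ℕ.* (2 ℕ.* q ℕ.* w ℕ.* r) ≡ w ℕ.* (4 ℕ.* q) ℕ.* r
        regroup = ℕ-Solver.solve-∀

open Fractions

-- The remainder of the series after the term n = N; `fullSum+remainder`
-- shows it is 2^k minus the sum of the terms up to N.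
remainder : ℕ → ℕ → ℚ
remainder k N = + remainderNumerator k N ℚ./ denom N
  where instance _ = denom≢0 N

term-fraction : ∀ k n → term k n ≡ (+ (4 ^ n ℕ.* stirlingU n k) ℚ./ denom n) {{denom≢0 n}}
term-fraction k n = cong (λ x → (x ℚ./ denom n) {{denom≢0 n}}) (term-numerator k n)

term-below : ∀ k n → n ℕ.< k → term k n ≡ 0ℚ
term-below k n n<k = begin
  term k n                                    ≡⟨ term-fraction k n ⟩
  + (4 ^ n ℕ.* stirlingU n k) ℚ./ denom n     ≡⟨ cong (λ x → + x ℚ./ denom n) numerator≡0 ⟩
  + 0 ℚ./ denom n                             ≡⟨ fraction-cong 0 0 (denom n) 1 refl ⟩
  0ℚ                                          ∎
  where open ≡-Reasoning
        instance _ = denom≢0 n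
        numerator≡0 : 4 ^ n ℕ.* stirlingU n k ≡ 0
        numerator≡0 = trans (cong (4 ^ n ℕ.*_) (stirlingU-above n k n<k)) (ℕP.*-zeroʳ (4 ^ n))

remainder-step : ∀ k N → term k (suc N) ℚ.+ remainder k (suc N) ≡ remainder k N
remainder-step k N = begin
  term k (suc N) ℚ.+ remainder k (suc N)  ≡⟨ cong (ℚ._+ remainder k (suc N)) (term-fraction k (suc N)) ⟩
  + a ℚ./ D′ ℚ.+ + b ℚ./ D′               ≡⟨ fraction-+ a b D′ ⟩
  + (a ℕ.+ b) ℚ./ D′                      ≡⟨ fraction-cong (a ℕ.+ b) c D′ D cross ⟩
  + c ℚ./ D                               ∎
  where
  open ≡-Reasoning
  instance _ = denom≢0 N
           _ = denom≢0 (suc N)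
  a  = 4 ^ suc N ℕ.* stirlingU (suc N) k
  b  = remainderNumerator k (suc N)
  c  = remainderNumerator k N
  D  = denom N
  D′ = denom (suc N)
  cross : (a ℕ.+ b) ℕ.* D ≡ c ℕ.* D′
  cross = begin
    (a ℕ.+ b) ℕ.* D                     ≡⟨ cong (ℕ._* D) (remainderNumerator-step k N) ⟩
    (4 ℕ.* N ℕ.+ 6) ℕ.* c ℕ.* D         ≡⟨ cong (ℕ._* D) (ℕP.*-comm (4 ℕ.* N ℕ.+ 6) c) ⟩
    c ℕ.* (4 ℕ.* N ℕ.+ 6) ℕ.* D         ≡⟨ ℕP.*-assoc c (4 ℕ.* N ℕ.+ 6) D ⟩
    c ℕ.* ((4 ℕ.* N ℕ.+ 6) ℕ.* D)       ≡⟨ cong (c ℕ.*_) (denom-step N) ⟨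
    c ℕ.* D′                            ∎

-- Σ_{n ≤ N} term k n, starting at n = 0 (the terms with n < k vanish).
fullSum : ℕ → ℕ → ℚ
fullSum k zero    = term k 0
fullSum k (suc N) = fullSum k N ℚ.+ term k (suc N)

fullSum+remainder : ∀ k N → fullSum k N ℚ.+ remainder k N ≡ + (2 ^ k) ℚ./ 1
fullSum+remainder k zero = begin
  term k 0 ℚ.+ remainder k 0                              ≡⟨ cong (ℚ._+ remainder k 0) (term-fraction k 0) ⟩
  + (1 ℕ.* stirlingU 0 k) ℚ./ 1 ℚ.+ + (2 ℕ.* 1 ℕ.* W) ℚ./ 1 ≡⟨ fraction-+ (1 ℕ.* stirlingU 0 k) (2 ℕ.* 1 ℕ.* W) 1 ⟩
  + (1 ℕ.* stirlingU 0 k ℕ.+ 2 ℕ.* 1 ℕ.* W) ℚ./ 1         ≡⟨ cong (λ x → + x ℚ./ 1) numerator ⟩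
  + (2 ^ k) ℚ./ 1                                          ∎
  where open ≡-Reasoning
        W = tailWeight k 1
        numerator : 1 ℕ.* stirlingU 0 k ℕ.+ 2 ℕ.* 1 ℕ.* W ≡ 2 ^ k
        numerator = trans (cong₂ ℕ._+_ (ℕP.*-identityˡ (stirlingU 0 k)) (cong (ℕ._* W) (ℕP.*-identityʳ 2)))
                          (tailWeight-initial k)
fullSum+remainder k (suc N) = begin
  (fullSum k N ℚ.+ term k (suc N)) ℚ.+ remainder k (suc N) ≡⟨ ℚP.+-assoc (fullSum k N) (term k (suc N)) (remainder k (suc N)) ⟩
  fullSum k N ℚ.+ (term k (suc N) ℚ.+ remainder k (suc N)) ≡⟨ cong (fullSum k N ℚ.+_) (remainder-step k N) ⟩
  fullSum k N ℚ.+ remainder k N                            ≡⟨ fullSum+remainder k N ⟩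
  + (2 ^ k) ℚ./ 1                                          ∎
  where open ≡-Reasoning

fullSum-below : ∀ k N → N ℕ.< k → fullSum k N ≡ 0ℚ
fullSum-below k zero    0<k   = term-below k 0 0<k
fullSum-below k (suc N) N+1<k = begin
  fullSum k N ℚ.+ term k (suc N) ≡⟨ cong₂ ℚ._+_ (fullSum-below k N (ℕP.<-trans (ℕP.n<1+n N) N+1<k))
                                                (term-below k (suc N) N+1<k) ⟩
  0ℚ ℚ.+ 0ℚ                     ≡⟨ ℚP.+-identityˡ 0ℚ ⟩
  0ℚ                             ∎
  where open ≡-Reasoning

fullSum-diagonal : ∀ k → fullSum k k ≡ term k k
fullSum-diagonal zero    = refl
fullSum-diagonal (suc k) = trans (cong (ℚ._+ term (suc k) (suc k)) (fullSum-below (suc k) k (ℕP.n<1+n k)))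
                                 (ℚP.+-identityˡ (term (suc k) (suc k)))

partialSum≡fullSum : ∀ k M → partialSum k M ≡ fullSum k (k ℕ.+ M)
partialSum≡fullSum k zero    = trans (sym (fullSum-diagonal k)) (cong (fullSum k) (sym (ℕP.+-identityʳ k)))
partialSum≡fullSum k (suc M) rewrite ℕP.+-suc k M =
  cong (ℚ._+ term k (suc (k ℕ.+ M))) (partialSum≡fullSum k M)

difference-of-sum : ∀ x y z → x ℚ.+ y ≡ z → x ℚ.- z ≡ ℚ.- y
difference-of-sum x y z x+y≡z = begin
  x ℚ.- z                        ≡⟨ cong (λ w → x ℚ.- w) x+y≡z ⟨
  x ℚ.+ ℚ.- (x ℚ.+ y)            ≡⟨ cong (x ℚ.+_) (ℚP.neg-distrib-+ x y) ⟩
  x ℚ.+ (ℚ.- x ℚ.+ ℚ.- y)        ≡⟨ ℚP.+-assoc x (ℚ.- x) (ℚ.- y) ⟨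
  (x ℚ.+ ℚ.- x) ℚ.+ ℚ.- y        ≡⟨ cong (ℚ._+ ℚ.- y) (ℚP.+-inverseʳ x) ⟩
  0ℚ ℚ.+ ℚ.- y                   ≡⟨ ℚP.+-identityˡ (ℚ.- y) ⟩
  ℚ.- y                          ∎
  where open ≡-Reasoning

distance≡remainder : ∀ k M → ∣ partialSum k M - (+ (2 ^ k)) / 1 ∣ ≡ remainder k (k ℕ.+ M)
distance≡remainder k M = begin
  ∣ partialSum k M - (+ (2 ^ k)) / 1 ∣   ≡⟨ cong (λ x → ∣ x - (+ (2 ^ k)) / 1 ∣) (partialSum≡fullSum k M) ⟩
  ∣ fullSum k N - (+ (2 ^ k)) / 1 ∣      ≡⟨ cong ∣_∣ (difference-of-sum (fullSum k N) (remainder k N) _ (fullSum+remainder k N)) ⟩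
  ∣ ℚ.- remainder k N ∣                  ≡⟨ ℚP.∣-p∣≡∣p∣ (remainder k N) ⟩
  ∣ remainder k N ∣                      ≡⟨ ℚP.0≤p⇒∣p∣≡p (fraction-nonNegative (remainderNumerator k N) (denom N) {{denom≢0 N}}) ⟩
  remainder k N                          ∎
  where open ≡-Reasoning
        N = k ℕ.+ M

remainder-below : ∀ k m N → (weightConstant 4 k ℕ.* suc m) ⁴ ≤ N → remainder k N < + 1 / suc m
remainder-below k m N X⁴≤N =
  fraction<reciprocal (remainderNumerator k N) (denom N) m {{denom≢0 N}} (remainderNumerator-bound k m N X⁴≤N)

mainTheorem9 : (k : ℕ) → (ε : ℚ) → 0ℚ < ε →
    ∃[ N ] ((M : ℕ) → N ≤ M → ∣ partialSum k M - (+ (2 ^ k)) / 1 ∣ < ε)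
mainTheorem9 k ε 0<ε with reciprocal-below ε 0<ε
... | m , 1/[m+1]≤ε = N₀ , close
  where
  N₀ = (weightConstant 4 k ℕ.* suc m) ⁴
  close : (M : ℕ) → N₀ ≤ M → ∣ partialSum k M - (+ (2 ^ k)) / 1 ∣ < ε
  close M N₀≤M = ℚP.<-≤-trans
    (subst (_< + 1 / suc m) (sym (distance≡remainder k M))
           (remainder-below k m (k ℕ.+ M) (ℕP.≤-trans N₀≤M (ℕP.m≤n+m M k))))
    1/[m+1]≤ε
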